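{- Every non-normal modal logic $L$ is sound and complete with respect to the class of bi-neighbourhood models for $L$: for every formula $A$ of $\mathcal L$, $A$ is valid in every bi-neighbourhood model for $L$ if and only if $\vdash_L A$.
   Context: The language $\mathcal L$ has formulas $A ::= p\mid\bot\mid\top\mid A\land A\mid A\lor A\mid A\to A\mid \Box A$ over countably many propositional variables, with $\neg A:=A\to\bot$ and $A\leftrightarrow B:=(A\to B)\land(B\to A)$. A non-normal modal logic $L$ is axiomatised by a complete axiomatisation of classical propositional logic in $\mathcal L$ with modus ponens, the rule RE: from $A\leftrightarrow B$ infer $\Box A\leftrightarrow\Box B$, plus any (possibly empty) selection of: M: $\Box(A\land B)\to\Box A$; C: $\Box A\land\Box B\to\Box(A\land B)$; N: $\Box\top$; T: $\Box A\to A$; D: $\neg(\Box A\land\Box\neg A)$; P: $\neg\Box\bot$; and, for any $n\ge1$, the rule RD$_n^+$: from $\neg(A_1\land\dots\land A_n)$ infer $\neg(\Box A_1\land\dots\land\Box A_n)$. A bi-neighbourhood model is $\langle\mathcal W,\mathcal N,\mathcal V\rangle$ with $\mathcal W\neq\emptyset$, $\mathcal N(w)\subseteq\mathcal P(\mathcal W)\times\mathcal P(\mathcal W)$ for each $w$, and $\mathcal V$ a valuation of propositional variables; forcing is classical on propositional connectives and $w\Vdash\Box A$ iff there is $(\alpha,\beta)\in\mathcal N(w)$ with $\alpha\subseteq[\![A]\!]\subseteq\mathcal W\setminus\beta$, where $[\![A]\!]=\{v\mid v\Vdash A\}$. $A$ is valid in a model if it is forced at every world. The bi-neighbourhood models for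 $L$ are those satisfying, for each axiom/rule X of $L$ other than RE, the condition (X) (for all $w$): (M) if $(\alpha,\beta)\in\mathcal N(w)$ then $\beta=\emptyset$; (N) there is $\alpha\subseteq\mathcal W$ with $(\alpha,\emptyset)\in\mathcal N(w)$ for all $w$; (C) if $(\alpha,\beta),(\gamma,\delta)\in\mathcal N(w)$ then $(\alpha\cap\gamma,\beta\cup\delta)\in\mathcal N(w)$; (T) if $(\alpha,\beta)\in\mathcal N(w)$ then $w\in\alpha$; (P) if $(\alpha,\beta)\in\mathcal N(w)$ then $\alpha\neq\emptyset$; (D) if $(\alpha,\beta),(\gamma,\delta)\in\mathcal N(w)$ then $\alpha\cap\gamma\neq\emptyset$ or $\beta\cap\delta\neq\emptyset$; (RD$_n^+$) if $(\alpha_1,\beta_1),\dots,(\alpha_n,\beta_n)\in\mathcal N(w)$ then $\alpha_1\cap\dots\cap\alpha_n\neq\emptyset$. -}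

module Defs where

open import Level using (Level; 0ℓ; Lift) renaming (suc to lsuc)
open import Data.Nat using (ℕ; suc)
open import Data.Bool using (Bool; true; false; _∧_; _∨_; not)
open import Data.Fin using (Fin)
open import Data.Vec using (Vec; []; _∷_; map)
open import Data.Product using (Σ; _×_; _,_)
open import Data.Sum using (_⊎_)
open import Data.Unit using (⊤)
open import Data.Empty using (⊥)
open import Relation.Binary.PropositionalEquality using (_≡_)
open import Relation.Unary using (Pred; _⊆_; ∁; ∅; _∩_; _∪_; Empty; Satisfiable)

infixr 6 _∧'_
infixr 5 _∨'_
infixr 4 _⇒_

data Form : Set where
  var  : ℕ → Form
  ⊥'   : Form
  ⊤'   : Form
  _∧'_ : Form → Form → Form
  _∨'_ : Form → Form → Form
  _⇒_  : Form → Form → Form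
  □    : Form → Form

¬' : Form → Form
¬' A = A ⇒ ⊥'

_⇔'_ : Form → Form → Form
A ⇔' B = (A ⇒ B) ∧' (B ⇒ A)

bigAnd : ∀ {n} → Vec Form (suc n) → Form
bigAnd (A ∷ []) = A
bigAnd (A ∷ B ∷ As) = A ∧' bigAnd (B ∷ As)

-- Classical propositional logic: a formula is a tautology if it is true
-- under every Boolean assignment to its propositional-atomic parts
-- (variables and □-formulas are treated as atoms).

evalB : (Form → Bool) → Form → Bool
evalB f (var p)  = f (var p)
evalB f ⊥'       = false
evalB f ⊤'       = true
evalB f (A ∧' B) = evalB f A ∧ evalB f B
evalB f (A ∨' B) = evalB f A ∨ evalB f B
evalB f (A ⇒ B)  = not (evalB f A) ∨ evalB f B
evalB f (□ A)    = f (□ A)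

Taut : Form → Set
Taut A = ∀ (f : Form → Bool) → evalB f A ≡ true

-- Selection of axioms / rules  (rd n is only consulted for n ≥ 1)

record Selection : Set where
  field
    M C N T D P : Bool
    RD : ℕ → Bool
open Selection public

data _⊢_ (S : Selection) : Form → Set where
  taut : ∀ {A} → Taut A → S ⊢ A
  mp   : ∀ {A B} → S ⊢ (A ⇒ B) → S ⊢ A → S ⊢ B
  re   : ∀ {A B} → S ⊢ (A ⇔' B) → S ⊢ (□ A ⇔' □ B)
  axM  : ∀ {A B} → M S ≡ true → S ⊢ (□ (A ∧' B) ⇒ □ A)
  axC  : ∀ {A B} → C S ≡ true → S ⊢ ((□ A ∧' □ B) ⇒ □ (A ∧' B))
  axN  : N S ≡ true → S ⊢ □ ⊤'
  axT  : ∀ {A} → T S ≡ true → S ⊢ (□ A ⇒ A)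
  axD  : ∀ {A} → D S ≡ true → S ⊢ ¬' (□ A ∧' □ (¬' A))
  axP  : P S ≡ true → S ⊢ ¬' (□ ⊥')
  rdn  : ∀ {k} (As : Vec Form (suc k)) → RD S (suc k) ≡ true →
         S ⊢ ¬' (bigAnd As) → S ⊢ ¬' (bigAnd (map □ As))

record Model : Set₁ where
  field
    W  : Set
    w₀ : W                                   -- W ≠ ∅
    𝒩  : W → Pred W 0ℓ → Pred W 0ℓ → Set
    𝒱  : ℕ → Pred W 0ℓ

module _ (𝔐 : Model) where
  open Model 𝔐

  infix 3 _⊩_
  _⊩_ : W → Form → Set₁
  w ⊩ var p  = Lift _ (𝒱 p w)
  w ⊩ ⊥'     = Lift _ ⊥
  w ⊩ ⊤'     = Lift _ ⊤
  w ⊩ A ∧' B = (w ⊩ A) × (w ⊩ B)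
  w ⊩ A ∨' B = (w ⊩ A) ⊎ (w ⊩ B)
  w ⊩ A ⇒ B  = (w ⊩ A) → (w ⊩ B)
  w ⊩ □ A    = Σ (Pred W 0ℓ) λ α → Σ (Pred W 0ℓ) λ β →
                 𝒩 w α β × (α ⊆ (λ v → v ⊩ A)) × ((λ v → v ⊩ A) ⊆ ∁ β)

  Valid : Form → Set₁
  Valid A = ∀ w → w ⊩ A

  CondM CondN CondC CondT CondP CondD : Set₁
  CondM = ∀ {w α β} → 𝒩 w α β → Empty β
  CondN = ∀ w → Σ (Pred W 0ℓ) λ α → 𝒩 w α ∅
  CondC = ∀ {w α β γ δ} → 𝒩 w α β → 𝒩 w γ δ → 𝒩 w (α ∩ γ) (β ∪ δ)
  CondT = ∀ {w α β} → 𝒩 w α β → α w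
  CondP = ∀ {w α β} → 𝒩 w α β → Satisfiable α
  CondD = ∀ {w α β γ δ} → 𝒩 w α β → 𝒩 w γ δ →
          Satisfiable (α ∩ γ) ⊎ Satisfiable (β ∩ δ)

  CondRD : ℕ → Set₁
  CondRD n = ∀ {w} (αs βs : Fin n → Pred W 0ℓ) →
             (∀ i → 𝒩 w (αs i) (βs i)) →
             Satisfiable (λ v → ∀ i → αs i v)

  IsModelFor : Selection → Set₁
  IsModelFor S =
      (M S ≡ true → CondM) × (N S ≡ true → CondN) × (C S ≡ true → CondC)
    × (T S ≡ true → CondT) × (P S ≡ true → CondP) × (D S ≡ true → CondD)
    × (∀ k → RD S (suc k) ≡ true → CondRD (suc k))

-- Soundness is checked axiom by axiom against the matching frame condition; a tautology is
-- valid because, by excluded middle, forcing at a world is a Boolean valuation of the atoms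
-- (variables and □-formulas).  Completeness uses a canonical model: worlds are maximal
-- consistent sets, obtained by Lindenbaum's construction along an enumeration of formulas,
-- and (α , β) is a neighbourhood pair of w iff α is the truth set of some X with □ X ∈ w and
-- β is the complement of that truth set, or empty if the logic contains M.  The truth lemma
-- for □ turns inclusions of truth sets into derivable implications, which RE (or RE with M)
-- lifts under □; each axiom of L then yields its frame condition in the canonical model.

module Submission where

open import Defs
open import Level using (0ℓ; lift; lower) renaming (suc to lsuc)
open import Axiom.ExcludedMiddle using (ExcludedMiddle)
open import Function.Base using (_∘_; id)
open import Function.Bundles using (_⇔_; mk⇔; Equivalence)
open import Function.Construct.Composition using (_⇔-∘_)
open import Function.Construct.Symmetry using (⇔-sym)
open import Function.Related.TypeIsomorphisms using (→-cong-⇔)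
open import Data.Product.Function.NonDependent.Propositional using (_×-⇔_)
open import Data.Sum.Function.Propositional using (_⊎-⇔_)
open import Data.Bool using (Bool; true; false; not; _∧_; _∨_)
import Data.Bool as Bool
open import Data.Bool.Properties using (T-∧; T-∨; T-≡)
open import Data.Nat using (ℕ; zero; suc; _⊔_; _≤′_; ≤′-reflexive; ≤′-step)
open import Data.Nat.Properties using (m≤m⊔n; m≤n⊔m; ≤⇒≤′)
open import Data.Fin using (Fin; zero; suc)
open import Data.Vec using (Vec; []; _∷_; lookup; map; tabulate)
open import Data.Vec.Properties using (lookup-map)
open import Data.Vec.Relation.Unary.All using (All; []; _∷_)
open import Data.Vec.Relation.Unary.All.Properties
  using (lookup⁺; lookup⁻; map⁺; map⁻; tabulate⁺; tabulate⁻)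
open import Data.List using (List; []; _∷_; _++_; cartesianProductWith)
import Data.List as List
import Data.List.Membership.Propositional as List
open import Data.List.Membership.Propositional.Properties
  using (∈-map⁺; ∈-++⁺ˡ; ∈-++⁺ʳ; ∈-cartesianProductWith⁺)
open import Data.List.Relation.Unary.Any using (here; there)
open import Data.Product using (Σ; ∃-syntax; _×_; _,_; proj₁; proj₂; uncurry)
open import Data.Sum using (_⊎_; inj₁; inj₂; [_,_]; [_,_]′)
open import Data.Unit using (tt)
open import Data.Empty using (⊥-elim)
open import Relation.Nullary using (¬_; Dec; yes; no)
open import Relation.Nullary.Decidable using (isYes; toWitness; fromWitness)
import Relation.Nullary.Decidable as Dec
open import Relation.Binary.PropositionalEquality using (_≡_; refl; sym; trans; cong₂)
open import Relation.Unary using (Pred; ∅; _∩_; _∪_; _⊆_; _≐_; Satisfiable)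
open import Relation.Unary.Properties using (≐-refl)

private
  variable
    n k : ℕ
    A B X Y Z : Form

infixr 6 _∧'_
infixr 5 _∨'_
infixr 4 _⇒_

-- Propositional schemas in n metavariables; overloading the constructors of Form
-- lets a schema be written exactly like the formulas it stands for.
data Schema (n : ℕ) : Set where
  var           : Fin n → Schema n
  ⊥'            : Schema n
  _∧'_ _∨'_ _⇒_ : Schema n → Schema n → Schema n

p : Schema (suc n)
p = var zero

q : Schema (suc (suc n))
q = var (suc zero)

r : Schema (suc (suc (suc n)))
r = var (suc (suc zero))

instantiate : Schema n → Vec Form n → Form
instantiate (var i)  Xs = lookup Xs i
instantiate ⊥'       Xs = ⊥'
instantiate (φ ∧' ψ) Xs = instantiate φ Xs ∧' instantiate ψ Xs
instantiate (φ ∨' ψ) Xs = instantiate φ Xs ∨' instantiate ψ Xs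
instantiate (φ ⇒ ψ)  Xs = instantiate φ Xs ⇒ instantiate ψ Xs

truthValue : Schema n → Vec Bool n → Bool
truthValue (var i)  bs = lookup bs i
truthValue ⊥'       bs = false
truthValue (φ ∧' ψ) bs = truthValue φ bs ∧ truthValue ψ bs
truthValue (φ ∨' ψ) bs = truthValue φ bs ∨ truthValue ψ bs
truthValue (φ ⇒ ψ)  bs = not (truthValue φ bs) ∨ truthValue ψ bs

evalB-instantiate : ∀ f (φ : Schema n) Xs →
                    evalB f (instantiate φ Xs) ≡ truthValue φ (map (evalB f) Xs)
evalB-instantiate f (var i)  Xs = sym (lookup-map i (evalB f) Xs)
evalB-instantiate f ⊥'       Xs = refl
evalB-instantiate f (φ ∧' ψ) Xs = cong₂ _∧_ (evalB-instantiate f φ Xs) (evalB-instantiate f ψ Xs)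
evalB-instantiate f (φ ∨' ψ) Xs = cong₂ _∨_ (evalB-instantiate f φ Xs) (evalB-instantiate f ψ Xs)
evalB-instantiate f (φ ⇒ ψ)  Xs =
  cong₂ (λ a b → not a ∨ b) (evalB-instantiate f φ Xs) (evalB-instantiate f ψ Xs)

trueEverywhere : ∀ n → (Vec Bool n → Bool) → Bool
trueEverywhere zero    g = g []
trueEverywhere (suc n) g = trueEverywhere n (g ∘ (true ∷_)) ∧ trueEverywhere n (g ∘ (false ∷_))

trueEverywhere-sound : ∀ n g → Bool.T (trueEverywhere n g) → ∀ bs → Bool.T (g bs)
trueEverywhere-sound zero    g t [] = t
trueEverywhere-sound (suc n) g t (true ∷ bs)  =
  trueEverywhere-sound n _ (proj₁ (Equivalence.to T-∧ t)) bs
trueEverywhere-sound (suc n) g t (false ∷ bs) =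
  trueEverywhere-sound n _ (proj₂ (Equivalence.to T-∧ t)) bs

IsTautology : Schema n → Set
IsTautology {n} φ = Bool.T (trueEverywhere n (truthValue φ))

Taut-instantiate : (φ : Schema n) → IsTautology φ → ∀ Xs → Taut (instantiate φ Xs)
Taut-instantiate {n} φ t Xs f = trans (evalB-instantiate f φ Xs)
  (Equivalence.to T-≡ (trueEverywhere-sound n (truthValue φ) t (map (evalB f) Xs)))

T-⇒ : ∀ {x y} → Bool.T (not x ∨ y) ⇔ (Bool.T x → Bool.T y)
T-⇒ {true}  = mk⇔ (λ y _ → y) (λ f → f tt)
T-⇒ {false} = mk⇔ (λ _ ()) (λ _ → tt)

bigAnd-All : ∀ {ℓ} (P : Form → Set ℓ) → (∀ {X Y} → P (X ∧' Y) ⇔ (P X × P Y)) →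
             (As : Vec Form (suc k)) → P (bigAnd As) ⇔ All P As
bigAnd-All P P-∧ (A ∷ [])     = mk⇔ (_∷ []) (λ { (a ∷ []) → a })
bigAnd-All P P-∧ (A ∷ B ∷ As) =
  mk⇔ (uncurry _∷_) (λ { (a ∷ as) → a , as })
    ⇔-∘ ((mk⇔ id id ×-⇔ bigAnd-All P P-∧ (B ∷ As)) ⇔-∘ P-∧)

module Reasoning (S : Selection) where

  infix 2 ⊢_
  ⊢_ : Form → Set
  ⊢ A = S ⊢ A

  -- IsTautology φ normalises to ⊤ for a tautologous closed φ, so it is filled in silently.
  tautology : (φ : Schema n) {_ : IsTautology φ} (Xs : Vec Form n) → ⊢ instantiate φ Xs
  tautology φ {t} Xs = taut (Taut-instantiate φ t Xs)

  mp₂ : ⊢ X ⇒ Y ⇒ Z → ⊢ X → ⊢ Y → ⊢ Z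
  mp₂ ⊢X⇒Y⇒Z ⊢X = mp (mp ⊢X⇒Y⇒Z ⊢X)

  ⊤-intro : ⊢ ⊤'
  ⊤-intro = taut λ _ → refl

  ⇒-refl : ⊢ X ⇒ X
  ⇒-refl {X} = tautology (p ⇒ p) (X ∷ [])

  ⇒-trans : ⊢ X ⇒ Y → ⊢ Y ⇒ Z → ⊢ X ⇒ Z
  ⇒-trans {X} {Y} {Z} = mp₂ (tautology ((p ⇒ q) ⇒ (q ⇒ r) ⇒ p ⇒ r) (X ∷ Y ∷ Z ∷ []))

  ⇒-const : ⊢ Y → ⊢ X ⇒ Y
  ⇒-const {Y} {X} = mp (tautology (p ⇒ q ⇒ p) (Y ∷ X ∷ []))

  ⇒-∧ : ⊢ X ⇒ Y → ⊢ X ⇒ Z → ⊢ X ⇒ Y ∧' Z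
  ⇒-∧ {X} {Y} {Z} = mp₂ (tautology ((p ⇒ q) ⇒ (p ⇒ r) ⇒ p ⇒ q ∧' r) (X ∷ Y ∷ Z ∷ []))

  ⇔-intro : ⊢ X ⇒ Y → ⊢ Y ⇒ X → ⊢ X ⇔' Y
  ⇔-intro {X} {Y} = mp₂ (tautology (p ⇒ q ⇒ p ∧' q) ((X ⇒ Y) ∷ (Y ⇒ X) ∷ []))

  ∧-elimˡ : ⊢ X ∧' Y → ⊢ X
  ∧-elimˡ {X} {Y} = mp (tautology (p ∧' q ⇒ p) (X ∷ Y ∷ []))

  □-cong : ⊢ X ⇔' Y → ⊢ □ X ⇒ □ Y
  □-cong = ∧-elimˡ ∘ re

  -- X is equivalent to Y ∧ X, and M drops the conjunct X.
  □-mono : M S ≡ true → ⊢ X ⇒ Y → ⊢ □ X ⇒ □ Y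
  □-mono {X} {Y} isM ⊢X⇒Y =
    ⇒-trans (□-cong (⇔-intro (⇒-∧ ⊢X⇒Y ⇒-refl) (tautology (p ∧' q ⇒ q) (Y ∷ X ∷ [])))) (axM isM)

module Soundness (lem : ExcludedMiddle (lsuc 0ℓ)) (𝔐 : Model) where
  open Model 𝔐

  infix 3 _⊨_
  _⊨_ : W → Form → Set₁
  _⊨_ = _⊩_ 𝔐

  valuation : W → Form → Bool
  valuation w B = isYes (lem {w ⊨ B})

  evalB-valuation : ∀ w A → Bool.T (evalB (valuation w) A) ⇔ (w ⊨ A)
  evalB-valuation w (var i)  = mk⇔ toWitness fromWitness
  evalB-valuation w ⊥'       = mk⇔ (λ ()) (λ ())
  evalB-valuation w ⊤'       = mk⇔ (λ _ → lift tt) (λ _ → tt)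
  evalB-valuation w (A ∧' B) = (evalB-valuation w A ×-⇔ evalB-valuation w B) ⇔-∘ T-∧
  evalB-valuation w (A ∨' B) = (evalB-valuation w A ⊎-⇔ evalB-valuation w B) ⇔-∘ T-∨
  evalB-valuation w (A ⇒ B)  = →-cong-⇔ (evalB-valuation w A) (evalB-valuation w B) ⇔-∘ T-⇒
  evalB-valuation w (□ A)    = mk⇔ toWitness fromWitness

  Taut-valid : Taut A → Valid 𝔐 A
  Taut-valid {A} t w = Equivalence.to (evalB-valuation w A) (Equivalence.from T-≡ (t (valuation w)))

  ⊨-bigAnd : ∀ w (As : Vec Form (suc k)) → (w ⊨ bigAnd As) ⇔ All (w ⊨_) As
  ⊨-bigAnd w = bigAnd-All (w ⊨_) (mk⇔ id id)

  □-monotone : (∀ v → v ⊨ A → v ⊨ B) → (∀ v → v ⊨ B → v ⊨ A) → ∀ w → w ⊨ □ A → w ⊨ □ B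
  □-monotone A⇒B B⇒A w (α , β , αβ∈𝒩 , α⊆A , A⊆∁β) =
    α , β , αβ∈𝒩 , (λ a → A⇒B _ (α⊆A a)) , (λ b → A⊆∁β (B⇒A _ b))

  RE-valid : Valid 𝔐 (A ⇔' B) → Valid 𝔐 (□ A ⇔' □ B)
  RE-valid A⇔B w = □-monotone (proj₁ ∘ A⇔B) (proj₂ ∘ A⇔B) w
                 , □-monotone (proj₂ ∘ A⇔B) (proj₁ ∘ A⇔B) w

  M-valid : CondM 𝔐 → Valid 𝔐 (□ (A ∧' B) ⇒ □ A)
  M-valid condM w (α , β , αβ∈𝒩 , α⊆A∧B , _) =
    α , β , αβ∈𝒩 , (proj₁ ∘ α⊆A∧B) , (λ _ → condM αβ∈𝒩 _)

  C-valid : CondC 𝔐 → Valid 𝔐 (□ A ∧' □ B ⇒ □ (A ∧' B))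
  C-valid condC w ((α , β , αβ∈𝒩 , α⊆A , A⊆∁β) , (γ , δ , γδ∈𝒩 , γ⊆B , B⊆∁δ)) =
    α ∩ γ , β ∪ δ , condC αβ∈𝒩 γδ∈𝒩 , (λ (a , c) → α⊆A a , γ⊆B c) ,
    (λ (a , b) → [ A⊆∁β a , B⊆∁δ b ])

  N-valid : CondN 𝔐 → Valid 𝔐 (□ ⊤')
  N-valid condN w = let α , α∅∈𝒩 = condN w in α , ∅ , α∅∈𝒩 , (λ _ → lift tt) , (λ _ ())

  T-valid : CondT 𝔐 → Valid 𝔐 (□ A ⇒ A)
  T-valid condT w (α , β , αβ∈𝒩 , α⊆A , _) = α⊆A (condT αβ∈𝒩)

  P-valid : CondP 𝔐 → Valid 𝔐 (¬' (□ ⊥'))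
  P-valid condP w (α , β , αβ∈𝒩 , α⊆⊥ , _) = α⊆⊥ (proj₂ (condP αβ∈𝒩))

  D-valid : CondD 𝔐 → Valid 𝔐 (¬' (□ A ∧' □ (¬' A)))
  D-valid condD w ((α , β , αβ∈𝒩 , α⊆A , A⊆∁β) , (γ , δ , γδ∈𝒩 , γ⊆¬A , ¬A⊆∁δ))
    with condD αβ∈𝒩 γδ∈𝒩
  ... | inj₁ (v , a , c) = γ⊆¬A c (α⊆A a)
  ... | inj₂ (v , b , d) = ⊥-elim (¬A⊆∁δ (λ a → ⊥-elim (A⊆∁β a b)) d)

  RD-valid : CondRD 𝔐 (suc k) → ∀ {As : Vec Form (suc k)} →
             Valid 𝔐 (¬' (bigAnd As)) → Valid 𝔐 (¬' (bigAnd (map □ As)))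
  RD-valid condRD {As} ¬As w □As = ¬As v (Equivalence.from (⊨-bigAnd v As) (lookup⁻ v⊨As))
    where
      nbhd : ∀ i → w ⊨ □ (lookup As i)
      nbhd = lookup⁺ (map⁻ (Equivalence.to (⊨-bigAnd w (map □ As)) □As))
      common : ∃[ v ] (∀ i → proj₁ (nbhd i) v)
      common = condRD (λ i → proj₁ (nbhd i)) (λ i → proj₁ (proj₂ (nbhd i)))
                      (λ i → proj₁ (proj₂ (proj₂ (nbhd i))))
      v : W
      v = proj₁ common
      v⊨As : ∀ i → v ⊨ lookup As i
      v⊨As i = proj₁ (proj₂ (proj₂ (proj₂ (nbhd i)))) (proj₂ common i)

  soundness : ∀ {S} → IsModelFor 𝔐 S → S ⊢ A → Valid 𝔐 A
  soundness m (taut t)   = Taut-valid t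
  soundness m (mp d e) w = soundness m d w (soundness m e w)
  soundness m (re d)     = RE-valid (soundness m d)
  soundness (condM , _) (axM isM) = M-valid (condM isM)
  soundness (_ , _ , condC , _) (axC isC) = C-valid (condC isC)
  soundness (_ , condN , _) (axN isN) = N-valid (condN isN)
  soundness (_ , _ , _ , condT , _) (axT isT) = T-valid (condT isT)
  soundness (_ , _ , _ , _ , _ , condD , _) (axD isD) = D-valid (condD isD)
  soundness (_ , _ , _ , _ , condP , _) (axP isP) = P-valid (condP isP)
  soundness m@(_ , _ , _ , _ , _ , _ , condRD) (rdn As isRD d) =
    RD-valid (condRD _ isRD) {As} (soundness m d)

products : (Form → Form → Form) → List Form → List Form
products _•_ Fs = cartesianProductWith _•_ Fs Fs

compounds : List Form → List Form
compounds Fs = List.map □ Fs ++ products _∧'_ Fs ++ products _∨'_ Fs ++ products _⇒_ Fs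

-- formulas n lists, with repetitions, the formulas of height below n over var 0, …, var (n ∸ 1).
formulas : ℕ → List Form
formulas zero    = []
formulas (suc n) = var n ∷ ⊥' ∷ ⊤' ∷ formulas n ++ compounds (formulas n)

module _ {Fs : List Form} where

  □-∈-compounds : X List.∈ Fs → □ X List.∈ compounds Fs
  □-∈-compounds = ∈-++⁺ˡ ∘ ∈-map⁺ □

  ∧-∈-compounds : X List.∈ Fs → Y List.∈ Fs → X ∧' Y List.∈ compounds Fs
  ∧-∈-compounds x y = ∈-++⁺ʳ (List.map □ Fs) (∈-++⁺ˡ (∈-cartesianProductWith⁺ _∧'_ x y))

  ∨-∈-compounds : X List.∈ Fs → Y List.∈ Fs → X ∨' Y List.∈ compounds Fs
  ∨-∈-compounds x y = ∈-++⁺ʳ (List.map □ Fs) (∈-++⁺ʳ (products _∧'_ Fs)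
    (∈-++⁺ˡ (∈-cartesianProductWith⁺ _∨'_ x y)))

  ⇒-∈-compounds : X List.∈ Fs → Y List.∈ Fs → (X ⇒ Y) List.∈ compounds Fs
  ⇒-∈-compounds x y = ∈-++⁺ʳ (List.map □ Fs) (∈-++⁺ʳ (products _∧'_ Fs)
    (∈-++⁺ʳ (products _∨'_ Fs) (∈-cartesianProductWith⁺ _⇒_ x y)))

formulas-suc : X List.∈ formulas n → X List.∈ formulas (suc n)
formulas-suc = there ∘ there ∘ there ∘ ∈-++⁺ˡ

compounds-∈-formulas : X List.∈ compounds (formulas n) → X List.∈ formulas (suc n)
compounds-∈-formulas {n = n} = there ∘ there ∘ there ∘ ∈-++⁺ʳ (formulas n)

formulas-mono : ∀ {m} → m ≤′ n → X List.∈ formulas m → X List.∈ formulas n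
formulas-mono (≤′-reflexive refl) = id
formulas-mono (≤′-step m≤′n)      = formulas-suc ∘ formulas-mono m≤′n

binary-∈-formulas :
  (∀ {n} → X List.∈ formulas n → Y List.∈ formulas n → Z List.∈ compounds (formulas n)) →
  ∃[ a ] X List.∈ formulas a → ∃[ b ] Y List.∈ formulas b → ∃[ n ] Z List.∈ formulas n
binary-∈-formulas compound (a , x) (b , y) =
  suc (a ⊔ b) , compounds-∈-formulas (compound (formulas-mono (≤⇒≤′ (m≤m⊔n a b)) x)
                                               (formulas-mono (≤⇒≤′ (m≤n⊔m a b)) y))

formulas-complete : ∀ X → ∃[ n ] X List.∈ formulas n
formulas-complete (var i)  = suc i , here refl
formulas-complete ⊥'       = 1 , there (here refl)
formulas-complete ⊤'       = 1 , there (there (here refl))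
formulas-complete (X ∧' Y) = binary-∈-formulas ∧-∈-compounds (formulas-complete X) (formulas-complete Y)
formulas-complete (X ∨' Y) = binary-∈-formulas ∨-∈-compounds (formulas-complete X) (formulas-complete Y)
formulas-complete (X ⇒ Y)  = binary-∈-formulas ⇒-∈-compounds (formulas-complete X) (formulas-complete Y)
formulas-complete (□ X)    =
  let n , x = formulas-complete X in suc n , compounds-∈-formulas (□-∈-compounds x)

module Completeness (lem : ExcludedMiddle (lsuc 0ℓ)) (S : Selection) where
  open Reasoning S

  dec : (X : Set) → Dec X
  dec X = Dec.map (mk⇔ lower lift) lem

  Consistent : Form → Set
  Consistent X = ¬ (⊢ ¬' X)

  Decides : Form → Form → Set
  Decides X B = (⊢ X ⇒ B) ⊎ (⊢ X ⇒ ¬' B)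

  Decides-⇒ : ⊢ Y ⇒ X → Decides X B → Decides Y B
  Decides-⇒ Y⇒X = [ inj₁ ∘ ⇒-trans Y⇒X , inj₂ ∘ ⇒-trans Y⇒X ]

  adjoin : Form → Form → Form
  adjoin B X with dec (⊢ ¬' (B ∧' X))
  ... | yes _ = ¬' B ∧' X
  ... | no  _ = B ∧' X

  adjoin-consistent : ∀ B → Consistent X → Consistent (adjoin B X)
  adjoin-consistent {X} B con with dec (⊢ ¬' (B ∧' X))
  ... | yes ⊢¬B∧X = λ ⊢¬¬B∧X →
          con (mp₂ (tautology ((p ∧' q ⇒ ⊥') ⇒ ((p ⇒ ⊥') ∧' q ⇒ ⊥') ⇒ q ⇒ ⊥') (B ∷ X ∷ []))
                   ⊢¬B∧X ⊢¬¬B∧X)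
  ... | no  ⊬¬B∧X = ⊬¬B∧X

  adjoin-⇒ : ∀ B → ⊢ adjoin B X ⇒ X
  adjoin-⇒ {X} B with dec (⊢ ¬' (B ∧' X))
  ... | yes _ = tautology (p ∧' q ⇒ q) (¬' B ∷ X ∷ [])
  ... | no  _ = tautology (p ∧' q ⇒ q) (B ∷ X ∷ [])

  adjoin-decides : ∀ B → Decides (adjoin B X) B
  adjoin-decides {X} B with dec (⊢ ¬' (B ∧' X))
  ... | yes _ = inj₂ (tautology (p ∧' q ⇒ p) (¬' B ∷ X ∷ []))
  ... | no  _ = inj₁ (tautology (p ∧' q ⇒ p) (B ∷ X ∷ []))

  adjoinAll : Form → List Form → Form
  adjoinAll X []       = X
  adjoinAll X (B ∷ Bs) = adjoinAll (adjoin B X) Bs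

  adjoinAll-consistent : ∀ Bs → Consistent X → Consistent (adjoinAll X Bs)
  adjoinAll-consistent []       con = con
  adjoinAll-consistent (B ∷ Bs) con = adjoinAll-consistent Bs (adjoin-consistent B con)

  adjoinAll-⇒ : ∀ Bs → ⊢ adjoinAll X Bs ⇒ X
  adjoinAll-⇒ []       = ⇒-refl
  adjoinAll-⇒ (B ∷ Bs) = ⇒-trans (adjoinAll-⇒ Bs) (adjoin-⇒ B)

  adjoinAll-decides : ∀ {Bs} → B List.∈ Bs → Decides (adjoinAll X Bs) B
  adjoinAll-decides {B} {Bs = B ∷ Bs} (here refl) = Decides-⇒ (adjoinAll-⇒ Bs) (adjoin-decides B)
  adjoinAll-decides (there b) = adjoinAll-decides b

  -- A maximal consistent set, presented by a descending chain of consistent formulas that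
  -- decides every formula at some stage (a predicate on Form would not fit in Set).
  record World : Set where
    field
      stage            : ℕ → Form
      stage-suc        : ∀ n → ⊢ stage (suc n) ⇒ stage n
      stage-consistent : ∀ n → Consistent (stage n)
      stage-decides    : ∀ B → ∃[ n ] Decides (stage n) B
  open World

  infix 4 _∈_ _∉_
  record _∈_ (B : Form) (w : World) : Set where
    constructor at
    field
      index  : ℕ
      stage⇒ : ⊢ stage w index ⇒ B

  _∉_ : Form → World → Set
  B ∉ w = ¬ (B ∈ w)

  lindenbaum : Consistent X → ∃[ w ] X ∈ w
  lindenbaum {X} con = w , at 0 ⇒-refl
    where
      chain : ℕ → Form
      chain zero    = X
      chain (suc n) = adjoinAll (chain n) (formulas n)

      chain-consistent : ∀ n → Consistent (chain n)
      chain-consistent zero    = con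
      chain-consistent (suc n) = adjoinAll-consistent (formulas n) (chain-consistent n)

      w : World
      w = record
        { stage            = chain
        ; stage-suc        = λ n → adjoinAll-⇒ (formulas n)
        ; stage-consistent = chain-consistent
        ; stage-decides    = λ B → let n , b = formulas-complete B in suc n , adjoinAll-decides b
        }

  module _ {w : World} where

    stage-antitone : ∀ {m n} → m ≤′ n → ⊢ stage w n ⇒ stage w m
    stage-antitone (≤′-reflexive refl) = ⇒-refl
    stage-antitone (≤′-step m≤′n)      = ⇒-trans (stage-suc w _) (stage-antitone m≤′n)

    ∈-closed : ⊢ X ⇒ Y → X ∈ w → Y ∈ w
    ∈-closed X⇒Y (at n x) = at n (⇒-trans x X⇒Y)

    ∈-theorem : ⊢ X → X ∈ w
    ∈-theorem ⊢X = at 0 (⇒-const ⊢X)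

    ∈-∧ : X ∈ w → Y ∈ w → X ∧' Y ∈ w
    ∈-∧ (at m x) (at n y) = at (m ⊔ n) (⇒-∧ (⇒-trans (stage-antitone (≤⇒≤′ (m≤m⊔n m n))) x)
                                            (⇒-trans (stage-antitone (≤⇒≤′ (m≤n⊔m m n))) y))

    ⊥'∉ : ⊥' ∉ w
    ⊥'∉ (at n ⊥) = stage-consistent w n ⊥

    ∈-or-¬'∈ : ∀ X → X ∈ w ⊎ ¬' X ∈ w
    ∈-or-¬'∈ X with stage-decides w X
    ... | n , inj₁ x  = inj₁ (at n x)
    ... | n , inj₂ ¬x = inj₂ (at n ¬x)

    ¬'∈⇒∉ : ¬' X ∈ w → X ∉ w
    ¬'∈⇒∉ {X} ¬x x = ⊥'∉ (∈-closed (tautology (p ∧' (p ⇒ ⊥') ⇒ ⊥') (X ∷ [])) (∈-∧ x ¬x))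

    ∉⇒¬'∈ : X ∉ w → ¬' X ∈ w
    ∉⇒¬'∈ {X} x∉ = [ (λ x → ⊥-elim (x∉ x)) , id ]′ (∈-or-¬'∈ X)

  _∈?_ : ∀ X w → Dec (X ∈ w)
  X ∈? w with ∈-or-¬'∈ {w} X
  ... | inj₁ x  = yes x
  ... | inj₂ ¬x = no (¬'∈⇒∉ ¬x)

  module _ {w : World} where

    ∈-∧⇔ : (X ∧' Y ∈ w) ⇔ (X ∈ w × Y ∈ w)
    ∈-∧⇔ {X} {Y} = mk⇔ (λ x∧y → ∈-closed (tautology (p ∧' q ⇒ p) (X ∷ Y ∷ [])) x∧y
                             , ∈-closed (tautology (p ∧' q ⇒ q) (X ∷ Y ∷ [])) x∧y)
                        (uncurry ∈-∧)

    ∈-∨⇔ : (X ∨' Y ∈ w) ⇔ (X ∈ w ⊎ Y ∈ w)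
    ∈-∨⇔ {X} {Y} = mk⇔ to
      [ ∈-closed (tautology (p ⇒ p ∨' q) (X ∷ Y ∷ [])) , ∈-closed (tautology (q ⇒ p ∨' q) (X ∷ Y ∷ [])) ]′
      where
        to : X ∨' Y ∈ w → X ∈ w ⊎ Y ∈ w
        to x∨y with X ∈? w
        ... | yes x = inj₁ x
        ... | no x∉ = inj₂ (∈-closed (tautology ((p ∨' q) ∧' (p ⇒ ⊥') ⇒ q) (X ∷ Y ∷ []))
                                     (∈-∧ x∨y (∉⇒¬'∈ x∉)))

    ∈-⇒⇔ : ((X ⇒ Y) ∈ w) ⇔ (X ∈ w → Y ∈ w)
    ∈-⇒⇔ {X} {Y} = mk⇔ (λ x⇒y x → ∈-closed (tautology ((p ⇒ q) ∧' p ⇒ q) (X ∷ Y ∷ [])) (∈-∧ x⇒y x)) from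
      where
        from : (X ∈ w → Y ∈ w) → (X ⇒ Y) ∈ w
        from x→y with X ∈? w
        ... | yes x = ∈-closed (tautology (q ⇒ p ⇒ q) (X ∷ Y ∷ [])) (x→y x)
        ... | no x∉ = ∈-closed (tautology ((p ⇒ ⊥') ⇒ p ⇒ q) (X ∷ Y ∷ [])) (∉⇒¬'∈ x∉)

    ∈-bigAnd : (Xs : Vec Form (suc k)) → (bigAnd Xs ∈ w) ⇔ All (_∈ w) Xs
    ∈-bigAnd = bigAnd-All (_∈ w) ∈-∧⇔

  ‖_‖ : Form → Pred World 0ℓ
  ‖ X ‖ w = X ∈ w

  refutable-or-satisfiable : ∀ X → (⊢ ¬' X) ⊎ Satisfiable ‖ X ‖
  refutable-or-satisfiable X with dec (⊢ ¬' X)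
  ... | yes ⊢¬X = inj₁ ⊢¬X
  ... | no  con = inj₂ (lindenbaum con)

  ‖‖-⊆⇒⊢ : ‖ X ‖ ⊆ ‖ Y ‖ → ⊢ X ⇒ Y
  ‖‖-⊆⇒⊢ {X} {Y} X⊆Y with refutable-or-satisfiable (X ∧' ¬' Y)
  ... | inj₁ ⊢¬[X∧¬Y] = mp (tautology (((p ∧' (q ⇒ ⊥')) ⇒ ⊥') ⇒ p ⇒ q) (X ∷ Y ∷ [])) ⊢¬[X∧¬Y]
  ... | inj₂ (v , x∧¬y) =
          let x , ¬y = Equivalence.to ∈-∧⇔ x∧¬y in ⊥-elim (¬'∈⇒∉ ¬y (X⊆Y x))

  -- For logics with M the second neighbourhood component is empty; otherwise it is the
  -- complement of the truth set.
  co‖_‖ : Form → Pred World 0ℓ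
  co‖ X ‖ w = M S ≡ false × X ∉ w

  𝒩ᶜ : World → Pred World 0ℓ → Pred World 0ℓ → Set
  𝒩ᶜ w α β = Σ Form λ X → □ X ∈ w × α ≐ ‖ X ‖ × β ≐ co‖ X ‖

  canonical : World → Model
  canonical w₀ = record { W = World ; w₀ = w₀ ; 𝒩 = 𝒩ᶜ ; 𝒱 = λ i → ‖ var i ‖ }

  □-∈-transfer : ∀ {w} → □ X ∈ w → ‖ X ‖ ⊆ ‖ Y ‖ → (M S ≡ false → ‖ Y ‖ ⊆ ‖ X ‖) → □ Y ∈ w
  □-∈-transfer □X X⊆Y Y⊆X with M S in isM
  ... | true  = ∈-closed (□-mono isM (‖‖-⊆⇒⊢ X⊆Y)) □X
  ... | false = ∈-closed (□-cong (⇔-intro (‖‖-⊆⇒⊢ X⊆Y) (‖‖-⊆⇒⊢ (Y⊆X refl)))) □X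

  ‖‖-∩ : ∀ {α γ : Pred World 0ℓ} → α ≐ ‖ X ‖ → γ ≐ ‖ Y ‖ → α ∩ γ ≐ ‖ X ∧' Y ‖
  ‖‖-∩ (α⊆X , X⊆α) (γ⊆Y , Y⊆γ) =
    (λ (a , c) → ∈-∧ (α⊆X a) (γ⊆Y c)) ,
    (λ x∧y → let x , y = Equivalence.to ∈-∧⇔ x∧y in X⊆α x , Y⊆γ y)

  co‖‖-∪ : ∀ {β δ : Pred World 0ℓ} → β ≐ co‖ X ‖ → δ ≐ co‖ Y ‖ → β ∪ δ ≐ co‖ X ∧' Y ‖
  co‖‖-∪ {X} {Y} (β⊆coX , coX⊆β) (δ⊆coY , coY⊆δ) = ∪⊆co , co⊆∪
    where
      ∪⊆co : _ ⊆ co‖ X ∧' Y ‖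
      ∪⊆co (inj₁ b) = let noM , x∉ = β⊆coX b in noM , x∉ ∘ proj₁ ∘ Equivalence.to ∈-∧⇔
      ∪⊆co (inj₂ d) = let noM , y∉ = δ⊆coY d in noM , y∉ ∘ proj₂ ∘ Equivalence.to ∈-∧⇔
      co⊆∪ : co‖ X ∧' Y ‖ ⊆ _
      co⊆∪ {v} (noM , x∧y∉) with X ∈? v
      ... | yes x = inj₂ (coY⊆δ (noM , λ y → x∧y∉ (∈-∧ x y)))
      ... | no x∉ = inj₁ (coX⊆β (noM , x∉))

  □∈⇒□¬'∉ : D S ≡ true → ∀ {w} → □ X ∈ w → □ (¬' X) ∉ w
  □∈⇒□¬'∉ isD □X □¬X = ¬'∈⇒∉ (∈-theorem (axD isD)) (∈-∧ □X □¬X)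

  module _ (w₀ : World) where

    infix 3 _⊨_
    _⊨_ : World → Form → Set₁
    _⊨_ = _⊩_ (canonical w₀)

    truth : ∀ A w → (w ⊨ A) ⇔ (A ∈ w)
    truth (var i)  w = mk⇔ lower lift
    truth ⊥'       w = mk⇔ (λ ()) (⊥-elim ∘ ⊥'∉)
    truth ⊤'       w = mk⇔ (λ _ → ∈-theorem ⊤-intro) (λ _ → lift tt)
    truth (A ∧' B) w = ⇔-sym ∈-∧⇔ ⇔-∘ (truth A w ×-⇔ truth B w)
    truth (A ∨' B) w = ⇔-sym ∈-∨⇔ ⇔-∘ (truth A w ⊎-⇔ truth B w)
    truth (A ⇒ B)  w = ⇔-sym ∈-⇒⇔ ⇔-∘ →-cong-⇔ (truth A w) (truth B w)
    truth (□ A)    w = mk⇔ forced⇒∈ ∈⇒forced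
      where
        ∈⇒forced : □ A ∈ w → w ⊨ □ A
        ∈⇒forced □A∈w = ‖ A ‖ , co‖ A ‖ , (A , □A∈w , ≐-refl , ≐-refl) ,
                        Equivalence.from (truth A _) , (λ a (_ , a∉) → a∉ (Equivalence.to (truth A _) a))

        forced⇒∈ : w ⊨ □ A → □ A ∈ w
        forced⇒∈ (α , β , (B , □B∈w , (_ , B⊆α) , (_ , coB⊆β)) , α⊆A , A⊆∁β) =
          □-∈-transfer □B∈w (λ b → Equivalence.to (truth A _) (α⊆A (B⊆α b))) A⊆B
          where
            A⊆B : M S ≡ false → ‖ A ‖ ⊆ ‖ B ‖
            A⊆B noM {v} a with B ∈? v
            ... | yes b = b
            ... | no b∉ = ⊥-elim (A⊆∁β (Equivalence.from (truth A v) a) (coB⊆β (noM , b∉)))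

    canonical-M : M S ≡ true → CondM (canonical w₀)
    canonical-M isM (X , _ , _ , β⊆coX , _) v b with () ← trans (sym isM) (proj₁ (β⊆coX b))

    canonical-N : N S ≡ true → CondN (canonical w₀)
    canonical-N isN w = ‖ ⊤' ‖ , ⊤' , ∈-theorem (axN isN) , ≐-refl ,
                        (λ ()) , (λ (_ , ⊤∉) → ⊤∉ (∈-theorem ⊤-intro))

    canonical-C : C S ≡ true → CondC (canonical w₀)
    canonical-C isC (X , □X , α≐ , β≐) (Y , □Y , γ≐ , δ≐) =
      X ∧' Y , ∈-closed (axC isC) (∈-∧ □X □Y) , ‖‖-∩ α≐ γ≐ , co‖‖-∪ β≐ δ≐

    canonical-T : T S ≡ true → CondT (canonical w₀)
    canonical-T isT (X , □X , (_ , X⊆α) , _) = X⊆α (∈-closed (axT isT) □X)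

    canonical-P : P S ≡ true → CondP (canonical w₀)
    canonical-P isP (X , □X , (_ , X⊆α) , _) with refutable-or-satisfiable X
    ... | inj₁ ⊢¬X = ⊥-elim (¬'∈⇒∉ (∈-theorem (axP isP))
                       (∈-closed (□-cong (⇔-intro ⊢¬X (tautology (⊥' ⇒ p) (X ∷ [])))) □X))
    ... | inj₂ (v , x) = v , X⊆α x

    canonical-D : D S ≡ true → CondD (canonical w₀)
    canonical-D isD (X , □X , (_ , X⊆α) , (_ , coX⊆β)) (Y , □Y , (_ , Y⊆γ) , (_ , coY⊆δ))
      with refutable-or-satisfiable (X ∧' Y)
    ... | inj₂ (v , x∧y) = let x , y = Equivalence.to ∈-∧⇔ x∧y in inj₁ (v , X⊆α x , Y⊆γ y)
    ... | inj₁ ⊢¬[X∧Y] with M S in isM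
    ...   | true = ⊥-elim (□∈⇒□¬'∉ isD □X (∈-closed (□-mono isM Y⇒¬X) □Y))
      where
        Y⇒¬X : ⊢ Y ⇒ ¬' X
        Y⇒¬X = mp (tautology ((p ∧' q ⇒ ⊥') ⇒ q ⇒ p ⇒ ⊥') (X ∷ Y ∷ [])) ⊢¬[X∧Y]
    ...   | false with refutable-or-satisfiable (¬' X ∧' ¬' Y)
    -- The with on M S has already turned M S into false in the types of coX⊆β and coY⊆δ.
    ...     | inj₂ (v , ¬x∧¬y) = let ¬x , ¬y = Equivalence.to ∈-∧⇔ ¬x∧¬y in
                                 inj₂ (v , coX⊆β (refl , ¬'∈⇒∉ ¬x) , coY⊆δ (refl , ¬'∈⇒∉ ¬y))
    ...     | inj₁ ⊢¬[¬X∧¬Y] = ⊥-elim (□∈⇒□¬'∉ isD □X (∈-closed (□-cong Y⇔¬X) □Y))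
      where
        Y⇔¬X : ⊢ Y ⇔' ¬' X
        Y⇔¬X = mp₂ (tautology ((p ∧' q ⇒ ⊥') ⇒ ((p ⇒ ⊥') ∧' (q ⇒ ⊥') ⇒ ⊥') ⇒
                              (q ⇒ p ⇒ ⊥') ∧' ((p ⇒ ⊥') ⇒ q)) (X ∷ Y ∷ []))
                   ⊢¬[X∧Y] ⊢¬[¬X∧¬Y]

    canonical-RD : ∀ k → RD S (suc k) ≡ true → CondRD (canonical w₀) (suc k)
    canonical-RD k isRD {w} αs βs nbhd =
      [ (λ ⊢¬Xs → ⊥-elim (¬'∈⇒∉ (∈-theorem (rdn Xs isRD ⊢¬Xs)) □Xs))
      , (λ (v , xs) → v , λ i → proj₂ (proj₁ (proj₂ (proj₂ (nbhd i))))
                                  (tabulate⁻ {f = proj₁ ∘ nbhd} (Equivalence.to (∈-bigAnd Xs) xs) i))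
      ]′ (refutable-or-satisfiable (bigAnd Xs))
      where
        Xs : Vec Form (suc k)
        Xs = tabulate (proj₁ ∘ nbhd)

        □Xs : bigAnd (map □ Xs) ∈ w
        □Xs = Equivalence.from (∈-bigAnd (map □ Xs)) (map⁺ (tabulate⁺ (proj₁ ∘ proj₂ ∘ nbhd)))

    canonical-isModelFor : IsModelFor (canonical w₀) S
    canonical-isModelFor = canonical-M , canonical-N , canonical-C , canonical-T ,
                           canonical-P , canonical-D , canonical-RD

  completeness : ((𝔐 : Model) → IsModelFor 𝔐 S → Valid 𝔐 A) → ⊢ A
  completeness {A} valid with refutable-or-satisfiable (¬' A)
  ... | inj₁ ⊢¬¬A = mp (tautology (((p ⇒ ⊥') ⇒ ⊥') ⇒ p) (A ∷ [])) ⊢¬¬A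
  ... | inj₂ (w , ¬a) = ⊥-elim (¬'∈⇒∉ ¬a (Equivalence.to (truth w A w)
                                   (valid (canonical w) (canonical-isModelFor w) w)))

mainTheorem4 : ExcludedMiddle (lsuc 0ℓ) →
    (S : Selection) (A : Form) →
    ((𝔐 : Model) → IsModelFor 𝔐 S → Valid 𝔐 A) ⇔ (S ⊢ A)
mainTheorem4 lem S A =
  mk⇔ (Completeness.completeness lem S) (λ ⊢A 𝔐 isModel → Soundness.soundness lem 𝔐 isModel ⊢A)
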